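{- For every allowed parameter pair $(k,h)$ and every extremal tree $T$ of Horton–Strahler number $k$ and height $h$, the number of leaves of $T$ equals $\alpha(k,h) := \sum_{i=0}^{k}\binom{h}{i}$. Moreover $\alpha(k,h) = \Theta(h^k)$ for fixed $k$.
   Context: Horton–Strahler number $\mathrm{hts}$ of a full binary tree: $0$ for the one-node tree; for a tree with subtrees $T_1,T_2$ it is $1+\mathrm{hts}(T_1)$ if $\mathrm{hts}(T_1)=\mathrm{hts}(T_2)$, else $\max(\mathrm{hts}(T_1),\mathrm{hts}(T_2))$. A pair $(k,h)\in\mathbb{N}_0^2$ with $h\ge k$ and ($k=0\Rightarrow h=0$) is an allowed parameter pair. For such a pair, a full binary tree $T$ is an extremal tree of Horton–Strahler number $k$ and height $h$ if $\mathrm{hts}(T)=k$, $T$ has height $h$, and every full binary tree $T'$ with $\mathrm{hts}(T')\le k$ and height $\le h$ has at most as many nodes as $T$. -}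

module Defs where

open import Data.Nat using (ℕ; zero; suc; _+_; _*_; _≤_; _⊔_; _≟_)
open import Relation.Nullary using (yes; no)
open import Data.Nat.Combinatorics using (_C_)
open import Relation.Binary.PropositionalEquality using (_≡_)
open import Data.Product using (_×_)

data Tree : Set where
  leaf : Tree
  node : Tree → Tree → Tree

hsCombine : ℕ → ℕ → ℕ
hsCombine a b with a ≟ b
... | yes _ = suc a
... | no _  = a ⊔ b

hts : Tree → ℕ
hts leaf = 0
hts (node l r) = hsCombine (hts l) (hts r)

height : Tree → ℕ
height leaf = 0
height (node l r) = suc (height l ⊔ height r)

size : Tree → ℕ
size leaf = 1
size (node l r) = suc (size l + size r)

leaves : Tree → ℕ
leaves leaf = 1
leaves (node l r) = leaves l + leaves r

Allowed : ℕ → ℕ → Set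
Allowed k h = (k ≤ h) × (k ≡ 0 → h ≡ 0)

Extremal : ℕ → ℕ → Tree → Set
Extremal k h T =
  (hts T ≡ k) × (height T ≡ h) ×
  (∀ (T' : Tree) → hts T' ≤ k → height T' ≤ h → size T' ≤ size T)

α : ℕ → ℕ → ℕ
α zero h = h C 0
α (suc k) h = α k h + h C (suc k)

-- A tree with Strahler number ≤ k+1 and height ≤ h+1 has one subtree with
-- Strahler number ≤ k and another with Strahler number ≤ k+1, both of height ≤ h,
-- so its leaf count obeys Pascal's recurrence α (k+1) (h+1) = α k h + α (k+1) h;
-- the tree built along this recurrence attains the bound. For full binary trees
-- the number of nodes is twice the number of leaves minus one, so an extremal
-- tree has the maximal number of leaves α k h. For the asymptotics,
-- h C k ≤ α k h ≤ (k+1) h^k, and the absorption identity gives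
-- h^k ≤ 2^k k! · (h C k) once h ≥ 2k.
module Submission where

open import Data.Empty using (⊥-elim)
open import Data.Nat
  using (ℕ; zero; suc; _+_; _*_; _^_; _∸_; _≟_; _≤_; z≤n; s≤s; _!; NonZero)
open import Data.Nat.Combinatorics using (_C_; nC1≡n; nCk+nC[k+1]≡[n+1]C[k+1])
open import Data.Nat.Properties
open import Data.Nat.Tactic.RingSolver using (solve-∀)
open import Data.Product using (_×_; _,_; Σ)
open import Data.Sum using (_⊎_; inj₁; inj₂)
open import Relation.Binary.Definitions using (tri<; tri≈; tri>)
open import Relation.Binary.PropositionalEquality
  using (_≡_; refl; sym; trans; cong; cong₂; subst; module ≡-Reasoning)
open import Relation.Nullary using (yes; no)

open import Defs

1≤hsCombine : ∀ a b → 1 ≤ hsCombine a b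
1≤hsCombine a b with a ≟ b
... | yes _ = s≤s z≤n
1≤hsCombine zero    zero    | no 0≢0 = ⊥-elim (0≢0 refl)
1≤hsCombine zero    (suc b) | no _   = s≤s z≤n
1≤hsCombine (suc a) b       | no _   = ≤-trans (s≤s z≤n) (m≤m⊔n (suc a) b)

hsCombine-≤-suc : ∀ a b {k} → hsCombine a b ≤ suc k →
                  (a ≤ k × b ≤ suc k) ⊎ (b ≤ k × a ≤ suc k)
hsCombine-≤-suc a b le with a ≟ b
hsCombine-≤-suc a .a (s≤s a≤k) | yes refl = inj₁ (a≤k , m≤n⇒m≤1+n a≤k)
... | no a≢b with <-cmp a b
... | tri< a<b _ _ = inj₁ (≤-pred (≤-trans a<b b≤1+k) , b≤1+k)
  where b≤1+k = ≤-trans (m≤n⊔m a b) le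
... | tri≈ _ a≡b _ = ⊥-elim (a≢b a≡b)
... | tri> _ _ b<a = inj₂ (≤-pred (≤-trans b<a a≤1+k) , a≤1+k)
  where a≤1+k = ≤-trans (m≤m⊔n a b) le

hsCombine-≤ : ∀ {a b k} → a ≤ k → b ≤ suc k → hsCombine a b ≤ suc k
hsCombine-≤ {a} {b} a≤k b≤1+k with a ≟ b
... | yes _ = s≤s a≤k
... | no _  = ⊔-lub (m≤n⇒m≤1+n a≤k) b≤1+k

1≤α : ∀ k h → 1 ≤ α k h
1≤α zero    h = s≤s z≤n
1≤α (suc k) h = ≤-trans (1≤α k h) (m≤m+n (α k h) (h C suc k))

α-zeroʳ : ∀ k → α k 0 ≡ 1
α-zeroʳ zero    = refl
α-zeroʳ (suc k) = trans (+-identityʳ (α k 0)) (α-zeroʳ k)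

α-pascal : ∀ k h → α (suc k) (suc h) ≡ α k h + α (suc k) h
α-pascal zero    h = cong suc (sym (nCk+nC[k+1]≡[n+1]C[k+1] h 0))
α-pascal (suc k) h = begin
  α (suc k) (suc h) + suc h C suc (suc k)
    ≡⟨ cong₂ _+_ (α-pascal k h) (sym (nCk+nC[k+1]≡[n+1]C[k+1] h (suc k))) ⟩
  (α k h + α (suc k) h) + (h C suc k + h C suc (suc k))
    ≡⟨ interchange (α k h) (α (suc k) h) (h C suc k) (h C suc (suc k)) ⟩
  (α k h + h C suc k) + (α (suc k) h + h C suc (suc k))
    ∎
  where
  open ≡-Reasoning
  interchange : ∀ a b c d → (a + b) + (c + d) ≡ (a + c) + (b + d)
  interchange = solve-∀

leaves≤α : ∀ t {k h} → hts t ≤ k → height t ≤ h → leaves t ≤ α k h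
leaves≤α leaf {k} {h} _ _ = 1≤α k h
leaves≤α (node l r) {zero} hts≤0 _ =
  ⊥-elim (1+n≰n (≤-trans (1≤hsCombine (hts l) (hts r)) hts≤0))
leaves≤α (node l r) {suc k} {suc h} hts≤ (s≤s height≤)
  with hsCombine-≤-suc (hts l) (hts r) hts≤
... | inj₁ (l≤k , r≤1+k) = begin
  leaves l + leaves r   ≤⟨ +-mono-≤ (leaves≤α l l≤k height-l≤) (leaves≤α r r≤1+k height-r≤) ⟩
  α k h + α (suc k) h   ≡⟨ α-pascal k h ⟨
  α (suc k) (suc h)     ∎
  where
  open ≤-Reasoning
  height-l≤ = ≤-trans (m≤m⊔n (height l) (height r)) height≤
  height-r≤ = ≤-trans (m≤n⊔m (height l) (height r)) height≤
... | inj₂ (r≤k , l≤1+k) = begin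
  leaves l + leaves r   ≤⟨ +-mono-≤ (leaves≤α l l≤1+k height-l≤) (leaves≤α r r≤k height-r≤) ⟩
  α (suc k) h + α k h   ≡⟨ +-comm (α (suc k) h) (α k h) ⟩
  α k h + α (suc k) h   ≡⟨ α-pascal k h ⟨
  α (suc k) (suc h)     ∎
  where
  open ≤-Reasoning
  height-l≤ = ≤-trans (m≤m⊔n (height l) (height r)) height≤
  height-r≤ = ≤-trans (m≤n⊔m (height l) (height r)) height≤

pascalTree : ℕ → ℕ → Tree
pascalTree zero    h       = leaf
pascalTree (suc k) zero    = leaf
pascalTree (suc k) (suc h) = node (pascalTree k h) (pascalTree (suc k) h)

hts-pascalTree : ∀ k h → hts (pascalTree k h) ≤ k
hts-pascalTree zero    h       = z≤n
hts-pascalTree (suc k) zero    = z≤n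
hts-pascalTree (suc k) (suc h) = hsCombine-≤ (hts-pascalTree k h) (hts-pascalTree (suc k) h)

height-pascalTree : ∀ k h → height (pascalTree k h) ≤ h
height-pascalTree zero    h       = z≤n
height-pascalTree (suc k) zero    = z≤n
height-pascalTree (suc k) (suc h) =
  s≤s (⊔-lub (height-pascalTree k h) (height-pascalTree (suc k) h))

leaves-pascalTree : ∀ k h → leaves (pascalTree k h) ≡ α k h
leaves-pascalTree zero    h       = refl
leaves-pascalTree (suc k) zero    = sym (α-zeroʳ (suc k))
leaves-pascalTree (suc k) (suc h) =
  trans (cong₂ _+_ (leaves-pascalTree k h) (leaves-pascalTree (suc k) h)) (sym (α-pascal k h))

1+size≡2*leaves : ∀ t → suc (size t) ≡ 2 * leaves t
1+size≡2*leaves leaf       = refl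
1+size≡2*leaves (node l r) = begin
  suc (suc (size l + size r))      ≡⟨ cong suc (+-suc (size l) (size r)) ⟨
  suc (size l) + suc (size r)      ≡⟨ cong₂ _+_ (1+size≡2*leaves l) (1+size≡2*leaves r) ⟩
  2 * leaves l + 2 * leaves r      ≡⟨ *-distribˡ-+ 2 (leaves l) (leaves r) ⟨
  2 * (leaves l + leaves r)        ∎
  where open ≡-Reasoning

size≤⇒leaves≤ : ∀ s t → size s ≤ size t → leaves s ≤ leaves t
size≤⇒leaves≤ s t size≤ = *-cancelˡ-≤ 2 (begin
  2 * leaves s     ≡⟨ 1+size≡2*leaves s ⟨
  suc (size s)     ≤⟨ s≤s size≤ ⟩
  suc (size t)     ≡⟨ 1+size≡2*leaves t ⟩
  2 * leaves t     ∎)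
  where open ≤-Reasoning

extremal⇒leaves≡α : ∀ {k h T} → Extremal k h T → leaves T ≡ α k h
extremal⇒leaves≡α {k} {h} {T} (hts≡k , height≡h , maximal) = ≤-antisym
  (leaves≤α T (≤-reflexive hts≡k) (≤-reflexive height≡h))
  (subst (_≤ leaves T) (leaves-pascalTree k h)
    (size≤⇒leaves≤ (pascalTree k h) T
      (maximal (pascalTree k h) (hts-pascalTree k h) (height-pascalTree k h))))

nCk≤n^k : ∀ n k → n C k ≤ n ^ k
nCk≤n^k n       zero    = ≤-refl
nCk≤n^k zero    (suc k) = z≤n
nCk≤n^k (suc n) (suc k) = begin
  suc n C suc k              ≡⟨ nCk+nC[k+1]≡[n+1]C[k+1] n k ⟨
  n C k + n C suc k          ≤⟨ +-mono-≤ (nCk≤n^k n k) (nCk≤n^k n (suc k)) ⟩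
  n ^ k + n * n ^ k          ≤⟨ +-mono-≤ n^k≤ (*-monoʳ-≤ n n^k≤) ⟩
  suc n ^ k + n * suc n ^ k  ∎
  where
  open ≤-Reasoning
  n^k≤ = ^-monoˡ-≤ k (n≤1+n n)

hCk≤α : ∀ k h → h C k ≤ α k h
hCk≤α zero    h = ≤-refl
hCk≤α (suc k) h = m≤n+m (h C suc k) (α k h)

α≤[1+k]*h^k : ∀ k h .{{_ : NonZero h}} → α k h ≤ suc k * h ^ k
α≤[1+k]*h^k zero    h = ≤-refl
α≤[1+k]*h^k (suc k) h = begin
  α k h + h C suc k              ≤⟨ +-mono-≤ (α≤[1+k]*h^k k h) (nCk≤n^k h (suc k)) ⟩
  suc k * h ^ k + h ^ suc k      ≤⟨ +-monoˡ-≤ (h ^ suc k) (*-monoʳ-≤ (suc k) (m≤n*m (h ^ k) h)) ⟩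
  suc k * h ^ suc k + h ^ suc k  ≡⟨ +-comm (suc k * h ^ suc k) (h ^ suc k) ⟩
  suc (suc k) * h ^ suc k        ∎
  where open ≤-Reasoning

[k+1]*[n+1]C[k+1]≡[n+1]*nCk : ∀ n k → suc k * (suc n C suc k) ≡ suc n * (n C k)
[k+1]*[n+1]C[k+1]≡[n+1]*nCk zero    zero    = refl
[k+1]*[n+1]C[k+1]≡[n+1]*nCk zero    (suc k) = *-zeroʳ (suc (suc k))
[k+1]*[n+1]C[k+1]≡[n+1]*nCk (suc n) zero    =
  trans (+-identityʳ (suc (suc n) C 1))
        (trans (nC1≡n (suc (suc n))) (sym (*-identityʳ (suc (suc n)))))
[k+1]*[n+1]C[k+1]≡[n+1]*nCk (suc n) (suc k) = begin
  suc (suc k) * (suc (suc n) C suc (suc k))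
    ≡⟨ cong (suc (suc k) *_) (nCk+nC[k+1]≡[n+1]C[k+1] (suc n) (suc k)) ⟨
  suc (suc k) * (suc n C suc k + suc n C suc (suc k))
    ≡⟨ expand (suc n C suc k) (suc n C suc (suc k)) k ⟩
  suc n C suc k + suc k * (suc n C suc k) + suc (suc k) * (suc n C suc (suc k))
    ≡⟨ cong₂ (λ x y → suc n C suc k + x + y)
             ([k+1]*[n+1]C[k+1]≡[n+1]*nCk n k) ([k+1]*[n+1]C[k+1]≡[n+1]*nCk n (suc k)) ⟩
  suc n C suc k + suc n * (n C k) + suc n * (n C suc k)
    ≡⟨ cong (λ x → x + suc n * (n C k) + suc n * (n C suc k)) (nCk+nC[k+1]≡[n+1]C[k+1] n k) ⟨
  (n C k + n C suc k) + suc n * (n C k) + suc n * (n C suc k)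
    ≡⟨ collect (n C k) (n C suc k) n ⟩
  suc (suc n) * (n C k + n C suc k)
    ≡⟨ cong (suc (suc n) *_) (nCk+nC[k+1]≡[n+1]C[k+1] n k) ⟩
  suc (suc n) * (suc n C suc k)
    ∎
  where
  open ≡-Reasoning
  expand : ∀ a b k → suc (suc k) * (a + b) ≡ a + suc k * a + suc (suc k) * b
  expand = solve-∀
  collect : ∀ a b n → (a + b) + suc n * a + suc n * b ≡ suc (suc n) * (a + b)
  collect = solve-∀

[k+1]*[k+e]C[k+1]≡e*[k+e]Ck : ∀ k e → suc k * ((k + e) C suc k) ≡ e * ((k + e) C k)
[k+1]*[k+e]C[k+1]≡e*[k+e]Ck k e = +-cancelʳ-≡ (suc k * a) (suc k * b) (e * a) (begin
  suc k * b + suc k * a          ≡⟨ factor a b k ⟩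
  suc k * (a + b)                ≡⟨ cong (suc k *_) (nCk+nC[k+1]≡[n+1]C[k+1] (k + e) k) ⟩
  suc k * (suc (k + e) C suc k)  ≡⟨ [k+1]*[n+1]C[k+1]≡[n+1]*nCk (k + e) k ⟩
  suc (k + e) * a                ≡⟨ split a k e ⟩
  e * a + suc k * a              ∎)
  where
  open ≡-Reasoning
  a = (k + e) C k
  b = (k + e) C suc k
  factor : ∀ a b k → suc k * b + suc k * a ≡ suc k * (a + b)
  factor = solve-∀
  split : ∀ a k e → suc (k + e) * a ≡ e * a + suc k * a
  split = solve-∀

[k+e]^k≤2^k*k!*[k+e]Ck : ∀ k e → k ≤ e → (k + e) ^ k ≤ 2 ^ k * k ! * ((k + e) C k)
[k+e]^k≤2^k*k!*[k+e]Ck zero    e _       = ≤-refl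
[k+e]^k≤2^k*k!*[k+e]Ck (suc k) e 1+k≤e = begin
  (suc k + e) ^ suc k
    ≡⟨ cong (_^ suc k) (+-suc k e) ⟨
  n * n ^ k
    ≤⟨ *-mono-≤ n≤2[1+e] ([k+e]^k≤2^k*k!*[k+e]Ck k (suc e) k≤1+e) ⟩
  (suc e + suc e) * (2 ^ k * k ! * (n C k))
    ≡⟨ regroup (suc e) (2 ^ k) (k !) (n C k) ⟩
  2 * 2 ^ k * k ! * (suc e * (n C k))
    ≡⟨ cong (2 * 2 ^ k * k ! *_) ([k+1]*[k+e]C[k+1]≡e*[k+e]Ck k (suc e)) ⟨
  2 * 2 ^ k * k ! * (suc k * (n C suc k))
    ≡⟨ reassoc (2 ^ k) (k !) k (n C suc k) ⟩
  2 ^ suc k * suc k ! * (n C suc k)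
    ≡⟨ cong (λ m → 2 ^ suc k * suc k ! * (m C suc k)) (+-suc k e) ⟩
  2 ^ suc k * suc k ! * ((suc k + e) C suc k)
    ∎
  where
  open ≤-Reasoning
  n = k + suc e
  k≤1+e = ≤-trans (n≤1+n k) (m≤n⇒m≤1+n 1+k≤e)
  n≤2[1+e] = +-monoˡ-≤ (suc e) k≤1+e
  regroup : ∀ e p f c → (e + e) * (p * f * c) ≡ 2 * p * f * (e * c)
  regroup = solve-∀
  reassoc : ∀ p f k c → 2 * p * f * (suc k * c) ≡ 2 * p * (f + k * f) * c
  reassoc = solve-∀

h^k≤2^k*k!*hCk : ∀ k h → k + k ≤ h → h ^ k ≤ 2 ^ k * k ! * (h C k)
h^k≤2^k*k!*hCk k h 2k≤h =
  subst (λ m → m ^ k ≤ 2 ^ k * k ! * (m C k)) k+[h∸k]≡h ([k+e]^k≤2^k*k!*[k+e]Ck k (h ∸ k) k≤h∸k)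
  where
  k+[h∸k]≡h = m+[n∸m]≡n (≤-trans (m≤m+n k k) 2k≤h)
  k≤h∸k = +-cancelˡ-≤ k k (h ∸ k) (subst (k + k ≤_) (sym k+[h∸k]≡h) 2k≤h)

α≍h^k : ∀ k → Σ ℕ λ c → Σ ℕ λ N →
        ∀ h → N ≤ h → (h ^ k ≤ suc c * α k h) × (α k h ≤ suc c * h ^ k)
α≍h^k k = k + d , suc (k + k) , λ h N≤h → lower h (≤-trans (n≤1+n (k + k)) N≤h) , upper h N≤h
  where
  d = 2 ^ k * k !
  d≤1+c = m≤n⇒m≤1+n (m≤n+m d k)
  1+k≤1+c = s≤s (m≤m+n k d)
  lower : ∀ h → k + k ≤ h → h ^ k ≤ suc (k + d) * α k h
  lower h 2k≤h = ≤-trans (h^k≤2^k*k!*hCk k h 2k≤h) (*-mono-≤ d≤1+c (hCk≤α k h))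
  upper : ∀ h → suc (k + k) ≤ h → α k h ≤ suc (k + d) * h ^ k
  upper h@(suc _) _ = ≤-trans (α≤[1+k]*h^k k h) (*-monoˡ-≤ (h ^ k) 1+k≤1+c)

lemma6p7 : (∀ (k h : ℕ) → Allowed k h → (T : Tree) → Extremal k h T → leaves T ≡ α k h)
    × (∀ (k : ℕ) → Σ ℕ λ c → Σ ℕ λ N →
    ∀ (h : ℕ) → N ≤ h → (h ^ k ≤ suc c * α k h) × (α k h ≤ suc c * h ^ k))
lemma6p7 = (λ k h _ T → extremal⇒leaves≡α) , α≍h^k
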